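{- In each of the calculi $\mathsf{DK},\mathsf{DK4},\mathsf{DGL},\mathsf{DS4},\mathsf{DT}$: let $\Delta;\Gamma\vdash M:A$ be derivable and suppose $M$ is a normal form for $\longrightarrow_c$ (there is no $N$ with $M\longrightarrow_c N$). Then every type occurring in the derivation of $\Delta;\Gamma\vdash M:A$ is a subexpression of the type $A$ or a subexpression of some type occurring in $\Delta$ or $\Gamma$.
   Context: Types: $A,B ::= p_i \mid A\times B\mid A\to B\mid \Box A$; subexpressions of a type are its syntactic subterms (including itself). Terms: $M,N ::= x \mid \lambda x{:}A.\,M \mid MN \mid \langle M,N\rangle \mid \pi_1(M)\mid\pi_2(M)\mid \mathsf{box}\,M \mid \mathsf{let\ box}\ u\Leftarrow M\ \mathsf{in}\ N \mid \mathsf{fix}\ z\ \mathsf{in}\ M$ (the $\mathsf{fix}$ form used in $\mathsf{DGL}$). Binding: $\lambda x$ binds $x$, $\mathsf{let\ box}\ u\Leftarrow M\ \mathsf{in}\ N$ binds $u$ in $N$, $\mathsf{fix}\ z$ binds $z$; terms up to $\alpha$-conversion, $N[M/x]$ capture-avoiding substitution. Contexts $\Gamma ::= \cdot\mid\Gamma,x{:}A$, $\mathrm{vars}(\Gamma)$ its set of variables. Complementation: a fixed involutive bijection $(-)^\bot$ on variables, extended pointwise to contexts and to terms by $x\mapsto x^\bot$, $(\lambda x{:}A.M)^\bot=\lambda x^\bot{:}A.M^\bot$, $(MN)^\bot=M^\bot N^\bot$, $\langle M,N\rangle^\bot=\langle M^\bot,N^\bot\rangle$, $\pi_i(M)^\bot=\pi_i(M^\bot)$,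 $(\mathsf{box}\,M)^\bot=\mathsf{box}\,M$, $(\mathsf{let\ box}\ u\Leftarrow M\ \mathsf{in}\ N)^\bot=\mathsf{let\ box}\ u\Leftarrow M^\bot\ \mathsf{in}\ N^\bot$. Judgments $\Delta;\Gamma\vdash M:A$ require well-defined contexts: $\mathrm{vars}(\Delta)\cap\mathrm{vars}(\Gamma)=\emptyset$, and in $\mathsf{DK4},\mathsf{DGL}$ also $\mathrm{vars}(\Gamma)\cap\mathrm{vars}(\Gamma^\bot)=\emptyset=\mathrm{vars}(\Delta)\cap\mathrm{vars}(\Delta^\bot)$. Common rules: $\Delta;\Gamma,x{:}A,\Gamma'\vdash x:A$; pairing $\langle M,N\rangle:A\times B$ from $M:A$, $N:B$; $\pi_i(M):A_i$ from $M:A_1\times A_2$; $\lambda x{:}A.M:A\to B$ from $\Delta;\Gamma,x{:}A\vdash M:B$; $MN:B$ from $M:A\to B$, $N:A$; from $\Delta;\Gamma\vdash M:\Box A$ and $\Delta,u{:}A;\Gamma\vdash N:C$ infer $\Delta;\Gamma\vdash\mathsf{let\ box}\ u\Leftarrow M\ \mathsf{in}\ N:C$. $\mathsf{DK}$: from $\cdot;\Delta\vdash M:A$ infer $\Delta;\Gamma\vdash\mathsf{box}\,M:\Box A$. $\mathsf{DK4}$: from $\Delta;\Delta^\bot\vdash M^\bot:A$ infer $\Delta;\Gamma\vdash\mathsf{box}\,M:\Box A$. $\mathsf{DGL}$: from $\Delta;\Delta^\bot,z^\bot{:}\Box A\vdash M^\bot:A$ infer $\Delta;\Gamma\vdash\mathsf{fix}\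 z\ \mathsf{in}\ M:\Box A$. $\mathsf{DS4}$: $\Delta,u{:}A,\Delta';\Gamma\vdash u:A$, and from $\Delta;\cdot\vdash M:A$ infer $\Delta;\Gamma\vdash\mathsf{box}\,M:\Box A$. $\mathsf{DT}$: the $\mathsf{DK}$ box rule together with $\Delta,u{:}A,\Delta';\Gamma\vdash u:A$. Base reduction: $(\lambda x{:}A.M)N\to M[N/x]$; $\pi_i(\langle M_1,M_2\rangle)\to M_i$; outside $\mathsf{DGL}$, $\mathsf{let\ box}\ u\Leftarrow\mathsf{box}\,M\ \mathsf{in}\ N\to N[M/u]$; in $\mathsf{DGL}$, $\mathsf{let\ box}\ u\Leftarrow\mathsf{fix}\ z\ \mathsf{in}\ M\ \mathsf{in}\ N\to N\big[M[\mathsf{fix}\ z\ \mathsf{in}\ M/z]/u\big]$. The relation $\longrightarrow_c$ is the compatible closure (closure under all term constructors, including under $\lambda$, $\mathsf{box}$, $\mathsf{fix}$, both arguments of application, pairing and both positions of $\mathsf{let\ box}$) of these base reductions together with the commuting conversions: $\pi_i(\mathsf{let\ box}\ u\Leftarrow M\ \mathsf{in}\ N)\longrightarrow_c \mathsf{let\ box}\ u\Leftarrow M\ \mathsf{in}\ \pi_i(N)$; $(\mathsf{let\ box}\ u\Leftarrow M\ \mathsf{in}\ P)\,Q\longrightarrow_c\mathsf{let\ box}\ u\Leftarrow M\ \mathsf{in}\ PQ$; $\mathsf{let\ box}\ v\Leftarrow(\mathsf{let\ box}\ u\Leftarrow M\ \mathsf{in}\ N)\ \mathsf{in}\ P\longrightarrow_c\mathsf{let\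 box}\ u\Leftarrow M\ \mathsf{in}\ (\mathsf{let\ box}\ v\Leftarrow N\ \mathsf{in}\ P)$ (with bound variables renamed to avoid capture). -}

module Defs where

open import Data.Nat using (ℕ; zero; suc; _⊔_; _≡ᵇ_)
open import Data.Bool using (Bool; true; false; if_then_else_; not)
open import Data.List using (List; []; _∷_; _++_; map; filter; foldr; concatMap)
open import Data.List.Membership.Propositional using (_∈_; _∉_)
open import Data.Product using (Σ; _×_; _,_; proj₁; proj₂)
open import Data.Sum using (_⊎_)
open import Relation.Binary.PropositionalEquality using (_≡_; _≢_)
open import Relation.Nullary using (¬_)
open import Relation.Nullary.Decidable using (¬?)
open import Data.Nat using (_≟_)

Var : Set
Var = ℕ

infixr 7 _⊗_
infixr 6 _⇒_
data Ty : Set where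
  p    : ℕ → Ty
  _⊗_  : Ty → Ty → Ty
  _⇒_  : Ty → Ty → Ty
  □_   : Ty → Ty

data _≼_ : Ty → Ty → Set where
  ≼-refl : ∀ {A} → A ≼ A
  ≼-×l   : ∀ {T A B} → T ≼ A → T ≼ (A ⊗ B)
  ≼-×r   : ∀ {T A B} → T ≼ B → T ≼ (A ⊗ B)
  ≼-→l   : ∀ {T A B} → T ≼ A → T ≼ (A ⇒ B)
  ≼-→r   : ∀ {T A B} → T ≼ B → T ≼ (A ⇒ B)
  ≼-□    : ∀ {T A} → T ≼ A → T ≼ (□ A)

data Tm : Set where
  var    : Var → Tm
  lam    : Var → Ty → Tm → Tm
  app    : Tm → Tm → Tm
  pair   : Tm → Tm → Tm
  fst    : Tm → Tm
  snd    : Tm → Tm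
  box    : Tm → Tm
  letbox : Var → Tm → Tm → Tm      -- let box u ⇐ M in N
  fix    : Var → Tm → Tm

record Involution : Set where
  field
    comp   : Var → Var
    invol  : ∀ x → comp (comp x) ≡ x

open Involution public

compTm : Involution → Tm → Tm
compTm ι (var x)        = var (comp ι x)
compTm ι (lam x A M)    = lam (comp ι x) A (compTm ι M)
compTm ι (app M N)      = app (compTm ι M) (compTm ι N)
compTm ι (pair M N)     = pair (compTm ι M) (compTm ι N)
compTm ι (fst M)        = fst (compTm ι M)
compTm ι (snd M)        = snd (compTm ι M)
compTm ι (box M)        = box M
compTm ι (letbox u M N) = letbox u (compTm ι M) (compTm ι N)
compTm ι (fix z M)      = fix z M

-- Contexts  (Γ , x:A  is written  (x , A) ∷ Γ)

Ctx : Set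
Ctx = List (Var × Ty)

vars : Ctx → List Var
vars = map proj₁

ctxTys : Ctx → List Ty
ctxTys = map proj₂

compCtx : Involution → Ctx → Ctx
compCtx ι = map (λ xa → comp ι (proj₁ xa) , proj₂ xa)

Disjoint : List Var → List Var → Set
Disjoint xs ys = ∀ x → x ∈ xs → x ∉ ys

data Calc : Set where
  DK DK4 DGL DS4 DT : Calc

WD : Involution → Calc → Ctx → Ctx → Set
WD ι c Δ Γ =
  Disjoint (vars Δ) (vars Γ) ×
  ((c ≡ DK4 ⊎ c ≡ DGL) →
     Disjoint (vars Γ) (vars (compCtx ι Γ)) × Disjoint (vars Δ) (vars (compCtx ι Δ)))

data Der (ι : Involution) (c : Calc) : Ctx → Ctx → Tm → Ty → Set where
  hyp   : ∀ {Δ Γ x A} → WD ι c Δ Γ → (x , A) ∈ Γ → Der ι c Δ Γ (var x) A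
  mhyp  : ∀ {Δ Γ u A} → (c ≡ DS4 ⊎ c ≡ DT) → WD ι c Δ Γ → (u , A) ∈ Δ →
          Der ι c Δ Γ (var u) A
  pairI : ∀ {Δ Γ M N A B} → WD ι c Δ Γ →
          Der ι c Δ Γ M A → Der ι c Δ Γ N B → Der ι c Δ Γ (pair M N) (A ⊗ B)
  fstE  : ∀ {Δ Γ M A B} → WD ι c Δ Γ →
          Der ι c Δ Γ M (A ⊗ B) → Der ι c Δ Γ (fst M) A
  sndE  : ∀ {Δ Γ M A B} → WD ι c Δ Γ →
          Der ι c Δ Γ M (A ⊗ B) → Der ι c Δ Γ (snd M) B
  lamI  : ∀ {Δ Γ x M A B} → WD ι c Δ Γ →
          Der ι c Δ ((x , A) ∷ Γ) M B → Der ι c Δ Γ (lam x A M) (A ⇒ B)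
  appE  : ∀ {Δ Γ M N A B} → WD ι c Δ Γ →
          Der ι c Δ Γ M (A ⇒ B) → Der ι c Δ Γ N A → Der ι c Δ Γ (app M N) B
  boxE  : ∀ {Δ Γ u M N A C} → WD ι c Δ Γ →
          Der ι c Δ Γ M (□ A) → Der ι c ((u , A) ∷ Δ) Γ N C →
          Der ι c Δ Γ (letbox u M N) C
  boxK  : ∀ {Δ Γ M A} → (c ≡ DK ⊎ c ≡ DT) → WD ι c Δ Γ →
          Der ι c [] Δ M A → Der ι c Δ Γ (box M) (□ A)
  box4  : ∀ {Δ Γ M A} → c ≡ DK4 → WD ι c Δ Γ →
          Der ι c Δ (compCtx ι Δ) (compTm ι M) A → Der ι c Δ Γ (box M) (□ A)
  fixI  : ∀ {Δ Γ z M A} → c ≡ DGL → WD ι c Δ Γ →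
          Der ι c Δ ((comp ι z , □ A) ∷ compCtx ι Δ) (compTm ι M) A →
          Der ι c Δ Γ (fix z M) (□ A)
  boxS4 : ∀ {Δ Γ M A} → c ≡ DS4 → WD ι c Δ Γ →
          Der ι c Δ [] M A → Der ι c Δ Γ (box M) (□ A)

judgTys : Ctx → Ctx → Ty → List Ty
judgTys Δ Γ A = ctxTys Δ ++ ctxTys Γ ++ (A ∷ [])

allTys : ∀ {ι c Δ Γ M A} → Der ι c Δ Γ M A → List Ty
allTys {Δ = Δ} {Γ} {A = A} d = judgTys Δ Γ A ++ premTys d
  where
  premTys : ∀ {ι c Δ Γ M A} → Der ι c Δ Γ M A → List Ty
  premTys (hyp _ _)        = []
  premTys (mhyp _ _ _)     = []
  premTys (pairI _ d₁ d₂)  = allTys d₁ ++ allTys d₂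
  premTys (fstE _ d₁)      = allTys d₁
  premTys (sndE _ d₁)      = allTys d₁
  premTys (lamI _ d₁)      = allTys d₁
  premTys (appE _ d₁ d₂)   = allTys d₁ ++ allTys d₂
  premTys (boxE _ d₁ d₂)   = allTys d₁ ++ allTys d₂
  premTys (boxK _ _ d₁)    = allTys d₁
  premTys (box4 _ _ d₁)    = allTys d₁
  premTys (fixI _ _ d₁)    = allTys d₁
  premTys (boxS4 _ _ d₁)   = allTys d₁

del : Var → List Var → List Var
del x = filter (λ y → ¬? (y ≟ x))

fv : Tm → List Var
fv (var x)        = x ∷ []
fv (lam x A M)    = del x (fv M)
fv (app M N)      = fv M ++ fv N
fv (pair M N)     = fv M ++ fv N
fv (fst M)        = fv M
fv (snd M)        = fv M
fv (box M)        = fv M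
fv (letbox u M N) = fv M ++ del u (fv N)
fv (fix z M)      = del z (fv M)

maxL : List Var → Var
maxL = foldr _⊔_ 0

freshFor : List Var → Var
freshFor xs = suc (maxL xs)

Subst : Set
Subst = Var → Tm

ext : Subst → Var → Var → Subst
ext σ y z w = if w ≡ᵇ y then var z else σ w

frB : Subst → Tm → Var
frB σ M = freshFor (concatMap (λ w → fv (σ w)) (fv M))

-- simultaneous capture-avoiding substitution (binders always renamed fresh)
subst : Subst → Tm → Tm
subst σ (var x)        = σ x
subst σ (lam y A M)    = lam (frB σ M) A (subst (ext σ y (frB σ M)) M)
subst σ (app M N)      = app (subst σ M) (subst σ N)
subst σ (pair M N)     = pair (subst σ M) (subst σ N)
subst σ (fst M)        = fst (subst σ M)
subst σ (snd M)        = snd (subst σ M)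
subst σ (box M)        = box (subst σ M)
subst σ (letbox u M N) = letbox (frB σ N) (subst σ M) (subst (ext σ u (frB σ N)) N)
subst σ (fix y M)      = fix (frB σ M) (subst (ext σ y (frB σ M)) M)

_[_/_] : Tm → Tm → Var → Tm
M [ N / x ] = subst (λ w → if w ≡ᵇ x then N else var w) M

data _⊢_⟶_ (c : Calc) : Tm → Tm → Set where
  β      : ∀ {x A M N} → c ⊢ app (lam x A M) N ⟶ (M [ N / x ])
  π₁β    : ∀ {M N} → c ⊢ fst (pair M N) ⟶ M
  π₂β    : ∀ {M N} → c ⊢ snd (pair M N) ⟶ N
  boxβ   : ∀ {u M N} → c ≢ DGL → c ⊢ letbox u (box M) N ⟶ (N [ M / u ])
  fixβ   : ∀ {u z M N} → c ≡ DGL →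
           c ⊢ letbox u (fix z M) N ⟶ (N [ M [ fix z M / z ] / u ])
  cc-fst : ∀ {u M N} → c ⊢ fst (letbox u M N) ⟶ letbox u M (fst N)
  cc-snd : ∀ {u M N} → c ⊢ snd (letbox u M N) ⟶ letbox u M (snd N)
  cc-app : ∀ {u M P Q} →
           c ⊢ app (letbox u M P) Q ⟶
             letbox (freshFor (fv P ++ fv Q)) M
                    (app (P [ var (freshFor (fv P ++ fv Q)) / u ]) Q)
  cc-box : ∀ {u v M N P} →
           c ⊢ letbox v (letbox u M N) P ⟶
             letbox (freshFor (fv N ++ fv P)) M
                    (letbox v (N [ var (freshFor (fv N ++ fv P)) / u ]) P)
  ξ-lam   : ∀ {x A M M'} → c ⊢ M ⟶ M' → c ⊢ lam x A M ⟶ lam x A M'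
  ξ-appl  : ∀ {M M' N} → c ⊢ M ⟶ M' → c ⊢ app M N ⟶ app M' N
  ξ-appr  : ∀ {M N N'} → c ⊢ N ⟶ N' → c ⊢ app M N ⟶ app M N'
  ξ-pairl : ∀ {M M' N} → c ⊢ M ⟶ M' → c ⊢ pair M N ⟶ pair M' N
  ξ-pairr : ∀ {M N N'} → c ⊢ N ⟶ N' → c ⊢ pair M N ⟶ pair M N'
  ξ-fst   : ∀ {M M'} → c ⊢ M ⟶ M' → c ⊢ fst M ⟶ fst M'
  ξ-snd   : ∀ {M M'} → c ⊢ M ⟶ M' → c ⊢ snd M ⟶ snd M'
  ξ-box   : ∀ {M M'} → c ⊢ M ⟶ M' → c ⊢ box M ⟶ box M'
  ξ-letl  : ∀ {u M M' N} → c ⊢ M ⟶ M' → c ⊢ letbox u M N ⟶ letbox u M' N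
  ξ-letr  : ∀ {u M N N'} → c ⊢ N ⟶ N' → c ⊢ letbox u M N ⟶ letbox u M N'
  ξ-fix   : ∀ {z M M'} → c ⊢ M ⟶ M' → c ⊢ fix z M ⟶ fix z M'

Normal : Calc → Tm → Set
Normal c M = ∀ N → ¬ (c ⊢ M ⟶ N)

module Submission where

-- Write  Xs ⊑ Zs  when every type in the list Xs is a subexpression of
-- some type in Zs; this is a preorder on lists of types.  The bounding
-- list of a judgment  Δ;Γ ⊢ M : A  is  A ∷ (types of Δ) ++ (types of Γ).
--
-- The argument is the classical one.  (1) A normal term headed by a
-- variable followed by eliminations (a "neutral" term) has a type that
-- is a subexpression of a context type.  (2) In a normal term, the
-- principal argument of an elimination is neutral: otherwise it is a
-- let-box (a commuting conversion applies) or an introduction of the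
-- matching connective (a β-rule applies).  (3) By induction on the
-- derivation, for every rule the bounds of each premise are ⊑ the
-- bounds of the conclusion: for introductions since the premise types
-- are components of the conclusion type or of the context, for
-- eliminations by (1) and (2).  The modal rules of DK4 and DGL type the
-- complement of the boxed term, so we also need that complementation
-- reflects reductions, whence preserves normality.

open import Defs
open import Data.List using (List; []; _∷_; _++_)
open import Data.List.Properties using (map-∘)
open import Data.List.Membership.Propositional using (_∈_)
open import Data.List.Membership.Propositional.Properties using (∈-++⁻; ∈-++⁺ˡ; ∈-++⁺ʳ; ∈-map⁺)
open import Data.List.Relation.Binary.Subset.Propositional using (_⊆_)
open import Data.List.Relation.Unary.Any using (here; there)
open import Data.Product using (Σ; ∃; _×_; _,_; proj₂)
open import Data.Sum using (_⊎_; inj₁; inj₂)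
open import Data.Empty using (⊥-elim)
open import Relation.Binary.PropositionalEquality using (_≡_; _≢_; refl; sym) renaming (subst to ≡-subst)

≼-trans : ∀ {T B C} → T ≼ B → B ≼ C → T ≼ C
≼-trans T≼B ≼-refl   = T≼B
≼-trans T≼B (≼-×l q) = ≼-×l (≼-trans T≼B q)
≼-trans T≼B (≼-×r q) = ≼-×r (≼-trans T≼B q)
≼-trans T≼B (≼-→l q) = ≼-→l (≼-trans T≼B q)
≼-trans T≼B (≼-→r q) = ≼-→r (≼-trans T≼B q)
≼-trans T≼B (≼-□ q)  = ≼-□ (≼-trans T≼B q)

Covered : List Ty → Ty → Set
Covered Zs T = Σ Ty (λ B → B ∈ Zs × T ≼ B)

_⊑_ : List Ty → List Ty → Set
Xs ⊑ Zs = ∀ {T} → T ∈ Xs → Covered Zs T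

covered-at : ∀ {Zs T B} → T ≼ B → B ∈ Zs → Covered Zs T
covered-at T≼B B∈Zs = _ , B∈Zs , T≼B

covered-≼ : ∀ {Zs T B} → T ≼ B → Covered Zs B → Covered Zs T
covered-≼ T≼B (C , C∈Zs , B≼C) = C , C∈Zs , ≼-trans T≼B B≼C

covered-⊑ : ∀ {Xs Zs T} → Xs ⊑ Zs → Covered Xs T → Covered Zs T
covered-⊑ Xs⊑Zs (B , B∈Xs , T≼B) = covered-≼ T≼B (Xs⊑Zs B∈Xs)

weaken-covered : ∀ {Zs T B} → Covered Zs T → Covered (B ∷ Zs) T
weaken-covered (C , C∈Zs , T≼C) = C , there C∈Zs , T≼C

⊆⇒⊑ : ∀ {Xs Zs} → Xs ⊆ Zs → Xs ⊑ Zs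
⊆⇒⊑ Xs⊆Zs T∈Xs = covered-at ≼-refl (Xs⊆Zs T∈Xs)

⊑-trans : ∀ {Xs Ys Zs} → Xs ⊑ Ys → Ys ⊑ Zs → Xs ⊑ Zs
⊑-trans Xs⊑Ys Ys⊑Zs T∈Xs = covered-⊑ Ys⊑Zs (Xs⊑Ys T∈Xs)

∷-⊑ : ∀ {Xs Zs A} → Covered Zs A → Xs ⊑ Zs → (A ∷ Xs) ⊑ Zs
∷-⊑ A-cov Xs⊑Zs (here refl) = A-cov
∷-⊑ A-cov Xs⊑Zs (there T∈Xs) = Xs⊑Zs T∈Xs

++-⊑ : ∀ Xs {Ys Zs} → Xs ⊑ Zs → Ys ⊑ Zs → (Xs ++ Ys) ⊑ Zs
++-⊑ Xs Xs⊑Zs Ys⊑Zs T∈XsYs with ∈-++⁻ Xs T∈XsYs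
... | inj₁ T∈Xs = Xs⊑Zs T∈Xs
... | inj₂ T∈Ys = Ys⊑Zs T∈Ys

bounds : Ctx → Ctx → Ty → List Ty
bounds Δ Γ A = A ∷ ctxTys Δ ++ ctxTys Γ

split-bounds : ∀ {Zs A T} → Covered (A ∷ Zs) T → T ≼ A ⊎ Covered Zs T
split-bounds (_ , here refl , T≼A) = inj₁ T≼A
split-bounds (B , there B∈Zs , T≼B) = inj₂ (B , B∈Zs , T≼B)

-- The lemmas are stated for
-- arbitrary lists; list arguments sitting to the left of _++_ are
-- explicit, since they cannot be recovered from  Xs ++ Ys  by unification.

below-goal : ∀ {A Θ T} → T ≼ A → Covered (A ∷ Θ) T
below-goal T≼A = covered-at T≼A (here refl)

hyps-⊑ : ∀ {A Θ} → Θ ⊑ (A ∷ Θ)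
hyps-⊑ = ⊆⇒⊑ there

prefix-⊑ : ∀ {A} Xs Ys → Xs ⊑ (A ∷ Xs ++ Ys)
prefix-⊑ Xs Ys = ⊆⇒⊑ (λ T∈Xs → there (∈-++⁺ˡ T∈Xs))

suffix-⊑ : ∀ {A} Xs Ys → Ys ⊑ (A ∷ Xs ++ Ys)
suffix-⊑ Xs Ys = ⊆⇒⊑ (λ T∈Ys → there (∈-++⁺ʳ Xs T∈Ys))

judgment-⊑ : ∀ Xs Ys {A} → (Xs ++ Ys ++ A ∷ []) ⊑ (A ∷ Xs ++ Ys)
judgment-⊑ Xs Ys = ++-⊑ Xs (prefix-⊑ Xs Ys) (++-⊑ Ys (suffix-⊑ Xs Ys) (∷-⊑ (below-goal ≼-refl) (λ ())))

retarget : ∀ {Θ A A'} → A ≼ A' → (A ∷ Θ) ⊑ (A' ∷ Θ)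
retarget A≼A' = ∷-⊑ (below-goal A≼A') hyps-⊑

retarget-hyps : ∀ {Θ A A'} → Covered Θ A → (A ∷ Θ) ⊑ (A' ∷ Θ)
retarget-hyps A-cov = ∷-⊑ (weaken-covered A-cov) hyps-⊑

lam-bounds : ∀ {A B} Xs Ys → (B ∷ Xs ++ A ∷ Ys) ⊑ (A ⇒ B ∷ Xs ++ Ys)
lam-bounds Xs Ys = ∷-⊑ (below-goal (≼-→r ≼-refl))
                       (++-⊑ Xs (prefix-⊑ Xs Ys) (∷-⊑ (below-goal (≼-→l ≼-refl)) (suffix-⊑ Xs Ys)))

letbox-bounds : ∀ {Θ A C} → Covered Θ (□ A) → (C ∷ A ∷ Θ) ⊑ (C ∷ Θ)
letbox-bounds □A-cov =
  ∷-⊑ (below-goal ≼-refl) (∷-⊑ (weaken-covered (covered-≼ (≼-□ ≼-refl) □A-cov)) hyps-⊑)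

modal-bounds : ∀ {Θ Θ' A} → Θ' ⊑ (□ A ∷ Θ) → (A ∷ Θ') ⊑ (□ A ∷ Θ)
modal-bounds = ∷-⊑ (below-goal (≼-□ ≼-refl))

∈-compCtx : ∀ ι Δ {T} → T ∈ ctxTys (compCtx ι Δ) → T ∈ ctxTys Δ
∈-compCtx ι Δ {T} = ≡-subst (T ∈_) (sym (map-∘ Δ))

compCtx-⊑ : ∀ ι Δ {Zs} → ctxTys Δ ⊑ Zs → ctxTys (compCtx ι Δ) ⊑ Zs
compCtx-⊑ ι Δ Δ⊑Zs T∈Δᶜ = Δ⊑Zs (∈-compCtx ι Δ T∈Δᶜ)

normal-under : ∀ {c M P} → (∀ {N} → c ⊢ M ⟶ N → ∃ (c ⊢ P ⟶_)) →
               Normal c P → Normal c M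
normal-under lift nf _ r = nf _ (proj₂ (lift r))

-- Complementation reflects reductions (redexes are never created by
-- renaming variables, and box/fix bodies are left untouched).
comp-reflects : ∀ {ι c M N} → c ⊢ compTm ι M ⟶ N → ∃ (c ⊢ M ⟶_)
comp-reflects {M = app (lam _ _ _) _}          β         = _ , β
comp-reflects {M = app (letbox _ _ _) _}       cc-app    = _ , cc-app
comp-reflects {M = fst (pair _ _)}             π₁β       = _ , π₁β
comp-reflects {M = fst (letbox _ _ _)}         cc-fst    = _ , cc-fst
comp-reflects {M = snd (pair _ _)}             π₂β       = _ , π₂β
comp-reflects {M = snd (letbox _ _ _)}         cc-snd    = _ , cc-snd
comp-reflects {M = letbox _ (box _) _}         (boxβ q)  = _ , boxβ q
comp-reflects {M = letbox _ (fix _ _) _}       (fixβ q)  = _ , fixβ q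
comp-reflects {M = letbox _ (letbox _ _ _) _}  cc-box    = _ , cc-box
comp-reflects {M = lam _ _ _}    (ξ-lam r)   = _ , ξ-lam (proj₂ (comp-reflects r))
comp-reflects {M = app _ _}      (ξ-appl r)  = _ , ξ-appl (proj₂ (comp-reflects r))
comp-reflects {M = app _ _}      (ξ-appr r)  = _ , ξ-appr (proj₂ (comp-reflects r))
comp-reflects {M = pair _ _}     (ξ-pairl r) = _ , ξ-pairl (proj₂ (comp-reflects r))
comp-reflects {M = pair _ _}     (ξ-pairr r) = _ , ξ-pairr (proj₂ (comp-reflects r))
comp-reflects {M = fst _}        (ξ-fst r)   = _ , ξ-fst (proj₂ (comp-reflects r))
comp-reflects {M = snd _}        (ξ-snd r)   = _ , ξ-snd (proj₂ (comp-reflects r))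
comp-reflects {M = box _}        (ξ-box r)   = _ , ξ-box r
comp-reflects {M = letbox _ _ _} (ξ-letl r)  = _ , ξ-letl (proj₂ (comp-reflects r))
comp-reflects {M = letbox _ _ _} (ξ-letr r)  = _ , ξ-letr (proj₂ (comp-reflects r))
comp-reflects {M = fix _ _}      (ξ-fix r)   = _ , ξ-fix r

normal-comp : ∀ {ι c M} → Normal c M → Normal c (compTm ι M)
normal-comp = normal-under comp-reflects

data Neutral : Tm → Set where
  var : ∀ {x} → Neutral (var x)
  app : ∀ {M N} → Neutral (app M N)
  fst : ∀ {M} → Neutral (fst M)
  snd : ∀ {M} → Neutral (snd M)

data Shape (c : Calc) : Tm → Ty → Set where
  neutral  : ∀ {M A} → Neutral M → Shape c M A
  letboxed : ∀ {u M N A} → Shape c (letbox u M N) A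
  lamᶜ     : ∀ {x A M B} → Shape c (lam x A M) (A ⇒ B)
  pairᶜ    : ∀ {M N A B} → Shape c (pair M N) (A ⊗ B)
  boxᶜ     : ∀ {M A} → c ≢ DGL → Shape c (box M) (□ A)
  fixᶜ     : ∀ {z M A} → c ≡ DGL → Shape c (fix z M) (□ A)

shape : ∀ {ι c Δ Γ M A} → Der ι c Δ Γ M A → Shape c M A
shape (hyp _ _)              = neutral var
shape (mhyp _ _ _)           = neutral var
shape (pairI _ _ _)          = pairᶜ
shape (fstE _ _)             = neutral fst
shape (sndE _ _)             = neutral snd
shape (lamI _ _)             = lamᶜ
shape (appE _ _ _)           = neutral app
shape (boxE _ _ _)           = letboxed
shape (boxK (inj₁ refl) _ _) = boxᶜ (λ ())
shape (boxK (inj₂ refl) _ _) = boxᶜ (λ ())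
shape (box4 refl _ _)        = boxᶜ (λ ())
shape (fixI refl _ _)        = fixᶜ refl
shape (boxS4 refl _ _)       = boxᶜ (λ ())

app-head-neutral : ∀ {c M N A B} → Shape c M (A ⇒ B) → Normal c (app M N) → Neutral M
app-head-neutral (neutral n) _ = n
app-head-neutral letboxed nf   = ⊥-elim (nf _ cc-app)
app-head-neutral lamᶜ nf       = ⊥-elim (nf _ β)

fst-head-neutral : ∀ {c M A B} → Shape c M (A ⊗ B) → Normal c (fst M) → Neutral M
fst-head-neutral (neutral n) _ = n
fst-head-neutral letboxed nf   = ⊥-elim (nf _ cc-fst)
fst-head-neutral pairᶜ nf      = ⊥-elim (nf _ π₁β)

snd-head-neutral : ∀ {c M A B} → Shape c M (A ⊗ B) → Normal c (snd M) → Neutral M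
snd-head-neutral (neutral n) _ = n
snd-head-neutral letboxed nf   = ⊥-elim (nf _ cc-snd)
snd-head-neutral pairᶜ nf      = ⊥-elim (nf _ π₂β)

letbox-head-neutral : ∀ {c M u N A} → Shape c M (□ A) → Normal c (letbox u M N) → Neutral M
letbox-head-neutral (neutral n) _ = n
letbox-head-neutral letboxed nf   = ⊥-elim (nf _ cc-box)
letbox-head-neutral (boxᶜ c≢DGL) nf = ⊥-elim (nf _ (boxβ c≢DGL))
letbox-head-neutral (fixᶜ c≡DGL) nf = ⊥-elim (nf _ (fixβ c≡DGL))

module _ {ι : Involution} {c : Calc} where

  mutual
    neutral-covered : ∀ {Δ Γ M A} → Der ι c Δ Γ M A → Normal c M → Neutral M →
                      Covered (ctxTys Δ ++ ctxTys Γ) A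
    neutral-covered {Δ} (hyp _ x∈Γ) _ _ =
      covered-at ≼-refl (∈-++⁺ʳ (ctxTys Δ) (∈-map⁺ proj₂ x∈Γ))
    neutral-covered (mhyp _ _ u∈Δ) _ _ = covered-at ≼-refl (∈-++⁺ˡ (∈-map⁺ proj₂ u∈Δ))
    neutral-covered (appE _ d _) nf _ = covered-≼ (≼-→r ≼-refl) (app-head-covered d nf)
    neutral-covered (fstE _ d) nf _   = covered-≼ (≼-×l ≼-refl) (fst-head-covered d nf)
    neutral-covered (sndE _ d) nf _   = covered-≼ (≼-×r ≼-refl) (snd-head-covered d nf)

    app-head-covered : ∀ {Δ Γ M N A B} → Der ι c Δ Γ M (A ⇒ B) → Normal c (app M N) →
                       Covered (ctxTys Δ ++ ctxTys Γ) (A ⇒ B)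
    app-head-covered d nf = neutral-covered d (normal-under (λ r → _ , ξ-appl r) nf)
                                            (app-head-neutral (shape d) nf)

    fst-head-covered : ∀ {Δ Γ M A B} → Der ι c Δ Γ M (A ⊗ B) → Normal c (fst M) →
                       Covered (ctxTys Δ ++ ctxTys Γ) (A ⊗ B)
    fst-head-covered d nf = neutral-covered d (normal-under (λ r → _ , ξ-fst r) nf)
                                            (fst-head-neutral (shape d) nf)

    snd-head-covered : ∀ {Δ Γ M A B} → Der ι c Δ Γ M (A ⊗ B) → Normal c (snd M) →
                       Covered (ctxTys Δ ++ ctxTys Γ) (A ⊗ B)
    snd-head-covered d nf = neutral-covered d (normal-under (λ r → _ , ξ-snd r) nf)
                                            (snd-head-neutral (shape d) nf)

  letbox-head-covered : ∀ {Δ Γ u M N A} → Der ι c Δ Γ M (□ A) → Normal c (letbox u M N) →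
                        Covered (ctxTys Δ ++ ctxTys Γ) (□ A)
  letbox-head-covered d nf = neutral-covered d (normal-under (λ r → _ , ξ-letl r) nf)
                                             (letbox-head-neutral (shape d) nf)

  with-judgment : ∀ Δ Γ A {Ps} → Ps ⊑ bounds Δ Γ A → (judgTys Δ Γ A ++ Ps) ⊑ bounds Δ Γ A
  with-judgment Δ Γ A = ++-⊑ (judgTys Δ Γ A) (judgment-⊑ (ctxTys Δ) (ctxTys Γ))

  subformula : ∀ {Δ Γ M A} (d : Der ι c Δ Γ M A) → Normal c M → allTys d ⊑ bounds Δ Γ A
  subformula {Δ} {Γ} {A = A} (hyp _ _) _ = with-judgment Δ Γ A (λ ())
  subformula {Δ} {Γ} {A = A} (mhyp _ _ _) _ = with-judgment Δ Γ A (λ ())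
  subformula {Δ} {Γ} {A = A} (pairI _ d₁ d₂) nf = with-judgment Δ Γ A (++-⊑ (allTys d₁)
    (⊑-trans (subformula d₁ (normal-under (λ r → _ , ξ-pairl r) nf)) (retarget (≼-×l ≼-refl)))
    (⊑-trans (subformula d₂ (normal-under (λ r → _ , ξ-pairr r) nf)) (retarget (≼-×r ≼-refl))))
  subformula {Δ} {Γ} {A = A} (fstE _ d) nf = with-judgment Δ Γ A
    (⊑-trans (subformula d (normal-under (λ r → _ , ξ-fst r) nf))
             (retarget-hyps (fst-head-covered d nf)))
  subformula {Δ} {Γ} {A = A} (sndE _ d) nf = with-judgment Δ Γ A
    (⊑-trans (subformula d (normal-under (λ r → _ , ξ-snd r) nf))
             (retarget-hyps (snd-head-covered d nf)))
  subformula {Δ} {Γ} {A = A} (lamI _ d) nf = with-judgment Δ Γ A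
    (⊑-trans (subformula d (normal-under (λ r → _ , ξ-lam r) nf)) (lam-bounds (ctxTys Δ) (ctxTys Γ)))
  subformula {Δ} {Γ} {A = B} (appE {A = A} _ d₁ d₂) nf = with-judgment Δ Γ B (++-⊑ (allTys d₁)
    (⊑-trans (subformula d₁ (normal-under (λ r → _ , ξ-appl r) nf)) (retarget-hyps A⇒B-cov))
    (⊑-trans (subformula d₂ (normal-under (λ r → _ , ξ-appr r) nf))
             (retarget-hyps (covered-≼ (≼-→l ≼-refl) A⇒B-cov))))
    where
    A⇒B-cov : Covered (ctxTys Δ ++ ctxTys Γ) (A ⇒ B)
    A⇒B-cov = app-head-covered d₁ nf
  subformula {Δ} {Γ} {A = C} (boxE {A = A} _ d₁ d₂) nf = with-judgment Δ Γ C (++-⊑ (allTys d₁)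
    (⊑-trans (subformula d₁ (normal-under (λ r → _ , ξ-letl r) nf)) (retarget-hyps □A-cov))
    (⊑-trans (subformula d₂ (normal-under (λ r → _ , ξ-letr r) nf)) (letbox-bounds □A-cov)))
    where
    □A-cov : Covered (ctxTys Δ ++ ctxTys Γ) (□ A)
    □A-cov = letbox-head-covered d₁ nf
  subformula {Δ} {Γ} {A = A} (boxK _ _ d) nf = with-judgment Δ Γ A
    (⊑-trans (subformula d (normal-under (λ r → _ , ξ-box r) nf))
             (modal-bounds (prefix-⊑ (ctxTys Δ) (ctxTys Γ))))
  subformula {Δ} {Γ} {A = A} (box4 {M = M} _ _ d) nf = with-judgment Δ Γ A
    (⊑-trans (subformula d (normal-comp {M = M} (normal-under (λ r → _ , ξ-box r) nf)))
             (modal-bounds (++-⊑ (ctxTys Δ) Δ-⊑ (compCtx-⊑ ι Δ Δ-⊑))))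
    where
    Δ-⊑ : ctxTys Δ ⊑ bounds Δ Γ A
    Δ-⊑ = prefix-⊑ (ctxTys Δ) (ctxTys Γ)
  subformula {Δ} {Γ} {A = A} (fixI {M = M} _ _ d) nf = with-judgment Δ Γ A
    (⊑-trans (subformula d (normal-comp {M = M} (normal-under (λ r → _ , ξ-fix r) nf)))
             (modal-bounds (++-⊑ (ctxTys Δ) Δ-⊑ (∷-⊑ (below-goal ≼-refl) (compCtx-⊑ ι Δ Δ-⊑)))))
    where
    Δ-⊑ : ctxTys Δ ⊑ bounds Δ Γ A
    Δ-⊑ = prefix-⊑ (ctxTys Δ) (ctxTys Γ)
  subformula {Δ} {Γ} {A = A} (boxS4 _ _ d) nf = with-judgment Δ Γ A
    (⊑-trans (subformula d (normal-under (λ r → _ , ξ-box r) nf))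
             (modal-bounds (++-⊑ (ctxTys Δ) (prefix-⊑ (ctxTys Δ) (ctxTys Γ)) (λ ()))))

theorem9 : (ι : Involution) (c : Calc) {Δ Γ : Ctx} {M : Tm} {A : Ty}
    (d : Der ι c Δ Γ M A) → Normal c M →
    ∀ T → T ∈ allTys d →
    T ≼ A ⊎ Σ Ty (λ B → B ∈ (ctxTys Δ ++ ctxTys Γ) × T ≼ B)
theorem9 ι c d nf T T∈d = split-bounds (subformula d nf T∈d)
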